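{- Let $G=(V,E)$ be a graph with $h(G)=2$, and let $u^*,v^*$ be two distinct vertices of maximum degree, i.e. $d(w)\le \min(d(u^*),d(v^*))$ for every $w\in V\setminus\{u^*,v^*\}$ (so every such $w$ has $d(w)\le 2$ and each connected component of $G[V\setminus\{u^*,v^*\}]$ is a path, possibly a single vertex, or a cycle). Let $S$ be a proportionally dense subgraph of $G$ with $|S|\ge \frac{|V|}{2}+1$. Then for every connected component $C$ of $G[V\setminus\{u^*,v^*\}]$ (path or cycle), either $C\subseteq S$ or $C\subseteq \overline{S}$. Moreover, if $u^*\notin S$ (resp. $v^*\notin S$) and an endpoint of a path component $P$ of $G[V\setminus\{u^*,v^*\}]$ is adjacent to $u^*$ (resp. $v^*$), then $P\subseteq \overline{S}$.
   Context: All graphs are finite, simple, undirected, with at least 3 vertices. The $h$-index $h(G)$ is the largest integer $h$ such that $G$ has at least $h$ vertices of degree at least $h$. For $X\subseteq V$, $d_X(v)=|N(v)\cap X|$ and $\overline{S}=V\setminus S$. A set $S\subset V$ with $2\le |S|<|V|$ is a proportionally dense subgraph (PDS) of $G$ if every $u\in S$ satisfies $\frac{d_S(u)}{|S|-1}\ge \frac{d_{\overline{S}}(u)}{|\overline{S}|}$. -}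

module Defs where

open import Data.Nat using (ℕ; _≤_; _<_; _*_; _+_; _∸_; _≤ᵇ_)
open import Data.Bool using (Bool; true; false)
open import Data.Fin using (Fin)
open import Data.Fin.Subset using (Subset; _∈_; _∉_; _∩_; ∁; ∣_∣; ⊤; _-_)
open import Data.Vec using (tabulate)
open import Data.Product using (_×_; ∃)
open import Data.Sum using (_⊎_)
open import Function.Bundles using (_⇔_)
open import Relation.Binary.PropositionalEquality using (_≡_)
open import Relation.Nullary using (¬_)

record Graph (n : ℕ) : Set where
  field
    adj     : Fin n → Fin n → Bool
    adj-sym : ∀ u v → adj u v ≡ adj v u
    irrefl  : ∀ v → adj v v ≡ false
open Graph public

module _ {n : ℕ} (G : Graph n) where

  nbhd : Fin n → Subset n
  nbhd v = tabulate (adj G v)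

  deg : Fin n → ℕ
  deg v = ∣ nbhd v ∣

  degIn : Subset n → Fin n → ℕ
  degIn X v = ∣ nbhd v ∩ X ∣

  countDegGE : ℕ → ℕ
  countDegGE k = ∣ tabulate (λ v → k ≤ᵇ deg v) ∣

  HIndexIs : ℕ → Set
  HIndexIs h = (h ≤ countDegGE h) × (∀ k → h < k → countDegGE k < k)

  -- S is a proportionally dense subgraph: 2 ≤ |S| < |V| and for all u ∈ S,
  -- d_S(u)/(|S|-1) ≥ d_{S̄}(u)/|S̄|, written with the (positive) denominators cleared.
  IsPDS : Subset n → Set
  IsPDS S = (2 ≤ ∣ S ∣) × (∣ S ∣ < n)
            × (∀ u → u ∈ S → degIn (∁ S) u * (∣ S ∣ ∸ 1) ≤ degIn S u * ∣ ∁ S ∣)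

  data Reach (X : Subset n) (x : Fin n) : Fin n → Set where
    here : x ∈ X → Reach X x x
    step : ∀ {y z} → Reach X x y → z ∈ X → adj G y z ≡ true → Reach X x z

  IsComponent : Subset n → Subset n → Set
  IsComponent X C = ∃ λ x → x ∈ X × (∀ y → (y ∈ C) ⇔ Reach X x y)

  -- x is an endpoint of the path component C of G[X]:
  -- x ∈ C and x has at most one neighbour inside C (a component containing such a
  -- vertex, in a graph of max degree 2, is a path; a single vertex counts as a path)
  IsPathEndpoint : Subset n → Fin n → Set
  IsPathEndpoint C x = x ∈ C × degIn C x ≤ 1

module Submission where

-- Since h(G) = 2, no third vertex can reach degree 3, so every vertex other than u*, v* has
-- degree at most 2. For such a vertex v ∈ S, |S| ≥ |V|/2 + 1 gives |S̄| < |S| − 1, while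
-- d_S(v) + d_S̄(v) ≤ 2 gives d_S(v) ≤ d_S̄(v) as soon as d_S̄(v) ≥ 1; then the PDS inequality
-- d_S̄(v)(|S| − 1) ≤ d_S(v)|S̄| fails. Hence S contains all neighbours of its vertices
-- outside {u*, v*}, so a component of G − {u*, v*} meeting S lies in S, and one with a vertex
-- adjacent to a vertex outside S lies outside S.

open import Defs
open import Data.Nat using (ℕ; zero; suc; _≤_; _<_; _+_; _*_; _∸_; _≤ᵇ_; z≤n; s≤s; s≤s⁻¹)
open import Data.Nat.Properties
  using (≤-refl; ≤-trans; ≤-<-trans; <-≤-trans; <⇒≱; ≰⇒>; _≤?_; +-suc; +-comm; +-assoc; +-identityʳ;
         +-cancelˡ-≤; m≤m+n; <-irrefl; ∸-monoˡ-≤; m+[n∸m]≡n; *-monoˡ-≤; *-monoʳ-<; ≤⇒≤ᵇ)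
open import Data.Fin using (Fin)
open import Data.Bool using (Bool; true)
open import Data.Bool.Properties using (T-≡)
open import Data.Vec using (_∷_; []; there; tabulate)
open import Data.Vec.Properties using (lookup⇒[]=; lookup∘tabulate)
open import Data.Fin.Subset using (Subset; _∈_; _∉_; _∩_; _─_; ∁; ∣_∣; ⊤; ⁅_⁆; _-_; _⊆_; inside; outside)
open import Data.Fin.Subset.Properties
  using (_∈?_; ∣p∣≤n; ∣∁p∣≡n∸∣p∣; x∈p∩q⁺; x∉p⇒x∈∁p; x∉∁p⇒x∈p; x∈⁅x⁆; p─q⊆p;
         x∈p∧x≢y⇒x∈p-y; x∈p⇒∣p-x∣<∣p∣)
open import Data.Product using (_×_; _,_)
open import Data.Sum using (_⊎_; inj₁; inj₂)
open import Data.Empty using (⊥-elim)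
open import Relation.Nullary using (yes; no)
open import Relation.Binary.PropositionalEquality using (_≡_; _≢_; refl; sym; trans; cong; subst; subst₂; module ≡-Reasoning)
open import Function.Base using (_∘_)
open import Function.Bundles using (Equivalence)

∈-tabulate⁺ : ∀ {n} (f : Fin n → Bool) {i : Fin n} → f i ≡ true → i ∈ tabulate f
∈-tabulate⁺ f {i} fi = lookup⇒[]= i (tabulate f) (trans (lookup∘tabulate f i) fi)

x∈p─q⇒x∉q : ∀ {n} (p q : Subset n) {x : Fin n} → x ∈ p ─ q → x ∉ q
x∈p─q⇒x∉q (_ ∷ p) (inside  ∷ q) (there x∈p─q) (there x∈q) = x∈p─q⇒x∉q p q x∈p─q x∈q
x∈p─q⇒x∉q (_ ∷ p) (outside ∷ q) (there x∈p─q) (there x∈q) = x∈p─q⇒x∉q p q x∈p─q x∈q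

x∈p-y⇒x≢y : ∀ {n} (p : Subset n) {x y : Fin n} → x ∈ p - y → x ≢ y
x∈p-y⇒x≢y p {x} x∈p-x refl = x∈p─q⇒x∉q p ⁅ x ⁆ x∈p-x (x∈⁅x⁆ x)

x∈p⇒1≤∣p∣ : ∀ {n} {p : Subset n} {x : Fin n} → x ∈ p → 1 ≤ ∣ p ∣
x∈p⇒1≤∣p∣ {p = p} x∈p = ≤-<-trans z≤n (x∈p⇒∣p-x∣<∣p∣ {p = p} x∈p)

distinct-triple⇒3≤∣p∣ : ∀ {n} {p : Subset n} {a b c : Fin n} →
  a ∈ p → b ∈ p → c ∈ p → b ≢ a → c ≢ a → c ≢ b → 3 ≤ ∣ p ∣
distinct-triple⇒3≤∣p∣ {p = p} {a} {b} a∈p b∈p c∈p b≢a c≢a c≢b =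
  <-≤-trans (s≤s (<-≤-trans (s≤s c∈p-a-b) (x∈p⇒∣p-x∣<∣p∣ b∈p-a))) (x∈p⇒∣p-x∣<∣p∣ a∈p)
  where
  b∈p-a : b ∈ p - a
  b∈p-a = x∈p∧x≢y⇒x∈p-y b∈p b≢a
  c∈p-a-b : 1 ≤ ∣ p - a - b ∣
  c∈p-a-b = x∈p⇒1≤∣p∣ (x∈p∧x≢y⇒x∈p-y (x∈p∧x≢y⇒x∈p-y c∈p c≢a) c≢b)

∣p∩q∣+∣p∩∁q∣≡∣p∣ : ∀ {n} (p q : Subset n) → ∣ p ∩ q ∣ + ∣ p ∩ ∁ q ∣ ≡ ∣ p ∣
∣p∩q∣+∣p∩∁q∣≡∣p∣ []            []            = refl
∣p∩q∣+∣p∩∁q∣≡∣p∣ (inside  ∷ p) (inside  ∷ q) = cong suc (∣p∩q∣+∣p∩∁q∣≡∣p∣ p q)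
∣p∩q∣+∣p∩∁q∣≡∣p∣ (inside  ∷ p) (outside ∷ q) = trans (+-suc _ _) (cong suc (∣p∩q∣+∣p∩∁q∣≡∣p∣ p q))
∣p∩q∣+∣p∩∁q∣≡∣p∣ (outside ∷ p) (inside  ∷ q) = ∣p∩q∣+∣p∩∁q∣≡∣p∣ p q
∣p∩q∣+∣p∩∁q∣≡∣p∣ (outside ∷ p) (outside ∷ q) = ∣p∩q∣+∣p∩∁q∣≡∣p∣ p q

∣p∣+∣∁p∣≡n : ∀ {n} (p : Subset n) → ∣ p ∣ + ∣ ∁ p ∣ ≡ n
∣p∣+∣∁p∣≡n p = trans (cong (∣ p ∣ +_) (∣∁p∣≡n∸∣p∣ p)) (m+[n∸m]≡n (∣p∣≤n p))

majority⇒∣∁p∣<∣p∣∸1 : ∀ {n} (p : Subset n) → n + 2 ≤ 2 * ∣ p ∣ → ∣ ∁ p ∣ < ∣ p ∣ ∸ 1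
majority⇒∣∁p∣<∣p∣∸1 {n} p big = ∸-monoˡ-≤ 1 (+-cancelˡ-≤ (∣ p ∣) (2 + ∣ ∁ p ∣) (∣ p ∣) p+2+c≤p+p)
  where
  open ≡-Reasoning
  p+2+c≡n+2 : ∣ p ∣ + (2 + ∣ ∁ p ∣) ≡ n + 2
  p+2+c≡n+2 = begin
    ∣ p ∣ + (2 + ∣ ∁ p ∣)  ≡⟨ cong (∣ p ∣ +_) (+-comm 2 ∣ ∁ p ∣) ⟩
    ∣ p ∣ + (∣ ∁ p ∣ + 2)  ≡⟨ sym (+-assoc ∣ p ∣ ∣ ∁ p ∣ 2) ⟩
    ∣ p ∣ + ∣ ∁ p ∣ + 2    ≡⟨ cong (_+ 2) (∣p∣+∣∁p∣≡n p) ⟩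
    n + 2                  ∎
  p+2+c≤p+p : ∣ p ∣ + (2 + ∣ ∁ p ∣) ≤ ∣ p ∣ + ∣ p ∣
  p+2+c≤p+p = subst₂ _≤_ (sym p+2+c≡n+2) (cong (∣ p ∣ +_) (+-identityʳ ∣ p ∣)) big

b+a≤2∧c<d∧a*d≤b*c⇒a≡0 : ∀ {a b c d : ℕ} → b + a ≤ 2 → c < d → a * d ≤ b * c → a ≡ 0
b+a≤2∧c<d∧a*d≤b*c⇒a≡0 {zero}              _    _   _      = refl
b+a≤2∧c<d∧a*d≤b*c⇒a≡0 {suc a} {b} {c} {d} b+a≤2 c<d ad≤bc = ⊥-elim (<⇒≱ bc<ad ad≤bc)
  where
  b≤1+a : b ≤ suc a
  b≤1+a = ≤-trans (≤-trans (m≤m+n b a) (s≤s⁻¹ (subst (_≤ 2) (+-suc b a) b+a≤2))) (s≤s z≤n)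
  bc<ad : b * c < suc a * d
  bc<ad = ≤-<-trans (*-monoˡ-≤ c b≤1+a) (*-monoʳ-< (suc a) c<d)

module _ {n : ℕ} (G : Graph n) where

  adj⇒∈nbhd : ∀ {v w} → adj G v w ≡ true → w ∈ nbhd G v
  adj⇒∈nbhd {v} = ∈-tabulate⁺ (adj G v)

  degIn+degIn∁≡deg : ∀ X v → degIn G X v + degIn G (∁ X) v ≡ deg G v
  degIn+degIn∁≡deg X v = ∣p∩q∣+∣p∩∁q∣≡∣p∣ (nbhd G v) X

  degIn≡0∧adj⇒∉ : ∀ {X v w} → degIn G X v ≡ 0 → adj G v w ≡ true → w ∉ X
  degIn≡0∧adj⇒∉ d≡0 vw w∈X = <-irrefl refl (subst (1 ≤_) d≡0 (x∈p⇒1≤∣p∣ (x∈p∩q⁺ (adj⇒∈nbhd vw , w∈X))))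

  distinct-triple⇒3≤countDegGE : ∀ {k a b c} → k ≤ deg G a → k ≤ deg G b → k ≤ deg G c →
    b ≢ a → c ≢ a → c ≢ b → 3 ≤ countDegGE G k
  distinct-triple⇒3≤countDegGE {k} ka kb kc = distinct-triple⇒3≤∣p∣ (member ka) (member kb) (member kc)
    where
    member : ∀ {v} → k ≤ deg G v → v ∈ tabulate (λ u → k ≤ᵇ deg G u)
    member k≤deg = ∈-tabulate⁺ _ (Equivalence.to T-≡ (≤⇒≤ᵇ k≤deg))

  hIndex2⇒deg≤2 : HIndexIs G 2 → ∀ {a b w} → a ≢ b → w ≢ a → w ≢ b →
    deg G w ≤ deg G a × deg G w ≤ deg G b → deg G w ≤ 2
  hIndex2⇒deg≤2 (_ , above2) {a} {b} {w} a≢b w≢a w≢b (w≤a , w≤b) with deg G w ≤? 2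
  ... | yes deg≤2 = deg≤2
  ... | no  deg≰2 = ⊥-elim (<⇒≱ (above2 3 ≤-refl)
          (distinct-triple⇒3≤countDegGE (≤-trans 3≤w w≤a) (≤-trans 3≤w w≤b) 3≤w (a≢b ∘ sym) w≢a w≢b))
    where
    3≤w : 3 ≤ deg G w
    3≤w = ≰⇒> deg≰2

  pds∧deg≤2⇒degIn∁≡0 : ∀ {S v} → IsPDS G S → n + 2 ≤ 2 * ∣ S ∣ → v ∈ S → deg G v ≤ 2 →
    degIn G (∁ S) v ≡ 0
  pds∧deg≤2⇒degIn∁≡0 {S} {v} (_ , _ , proportional) big v∈S deg≤2 =
    b+a≤2∧c<d∧a*d≤b*c⇒a≡0 (subst (_≤ 2) (sym (degIn+degIn∁≡deg S v)) deg≤2)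
      (majority⇒∣∁p∣<∣p∣∸1 S big) (proportional v v∈S)

  pds∧deg≤2∧adj⇒∈ : ∀ {S v w} → IsPDS G S → n + 2 ≤ 2 * ∣ S ∣ → v ∈ S → deg G v ≤ 2 →
    adj G v w ≡ true → w ∈ S
  pds∧deg≤2∧adj⇒∈ pds big v∈S deg≤2 vw = x∉∁p⇒x∈p (degIn≡0∧adj⇒∉ (pds∧deg≤2⇒degIn∁≡0 pds big v∈S deg≤2) vw)

  NeighbourClosed : Subset n → Subset n → Set
  NeighbourClosed X S = ∀ {v w} → v ∈ X → v ∈ S → adj G v w ≡ true → w ∈ S

  Reach⇒∈ : ∀ {X x y} → Reach G X x y → y ∈ X
  Reach⇒∈ (here x∈X)     = x∈X
  Reach⇒∈ (step _ z∈X _) = z∈X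

  Reach-preserves-∈ : ∀ {X S x y} → NeighbourClosed X S → Reach G X x y → x ∈ S → y ∈ S
  Reach-preserves-∈ closed (here _)       x∈S = x∈S
  Reach-preserves-∈ closed (step r _ yz) x∈S = closed (Reach⇒∈ r) (Reach-preserves-∈ closed r x∈S) yz

  Reach-reflects-∈ : ∀ {X S x y} → NeighbourClosed X S → Reach G X x y → y ∈ S → x ∈ S
  Reach-reflects-∈ closed (here _)                 x∈S = x∈S
  Reach-reflects-∈ closed (step {y} {z} r z∈X yz) z∈S =
    Reach-reflects-∈ closed r (closed z∈X z∈S (trans (adj-sym G z y) yz))

  component⊆ : ∀ {X C} → IsComponent G X C → C ⊆ X
  component⊆ (_ , _ , C⇔reach) y∈C = Reach⇒∈ (Equivalence.to (C⇔reach _) y∈C)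

  component⊆∨⊆∁ : ∀ {X S C} → NeighbourClosed X S → IsComponent G X C → C ⊆ S ⊎ C ⊆ ∁ S
  component⊆∨⊆∁ {S = S} closed (x , _ , C⇔reach) with x ∈? S
  ... | yes x∈S = inj₁ λ y∈C → Reach-preserves-∈ closed (Equivalence.to (C⇔reach _) y∈C) x∈S
  ... | no  x∉S = inj₂ λ y∈C → x∉p⇒x∈∁p (x∉S ∘ Reach-reflects-∈ closed (Equivalence.to (C⇔reach _) y∈C))

  component∧adj∉⇒⊆∁ : ∀ {X S C x y} → NeighbourClosed X S → IsComponent G X C →
    x ∈ C → adj G x y ≡ true → y ∉ S → C ⊆ ∁ S
  component∧adj∉⇒⊆∁ closed comp x∈C xy y∉S with component⊆∨⊆∁ closed comp
  ... | inj₁ C⊆S  = ⊥-elim (y∉S (closed (component⊆ comp x∈C) (C⊆S x∈C) xy))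
  ... | inj₂ C⊆∁S = C⊆∁S

lemma9 : ∀ {n} (G : Graph n) → 3 ≤ n → HIndexIs G 2
    → (u* v* : Fin n) → u* ≢ v*
    → (∀ w → w ≢ u* → w ≢ v* → deg G w ≤ deg G u* × deg G w ≤ deg G v*)
    → (S : Subset n) → IsPDS G S → n + 2 ≤ 2 * ∣ S ∣
    → (∀ C → IsComponent G ((⊤ - u*) - v*) C → C ⊆ S ⊎ C ⊆ ∁ S)
    × (∀ P x → IsComponent G ((⊤ - u*) - v*) P → IsPathEndpoint G P x
    → ((u* ∉ S × adj G x u* ≡ true) ⊎ (v* ∉ S × adj G x v* ≡ true))
    → P ⊆ ∁ S)
lemma9 G _ hIndex u* v* u*≢v* maxdeg S pds big = (λ _ → component⊆∨⊆∁ G closed) , leaves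
  where
  X : Subset _
  X = (⊤ - u*) - v*

  closed : NeighbourClosed G X S
  closed {v} v∈X v∈S = pds∧deg≤2∧adj⇒∈ G pds big v∈S
    (hIndex2⇒deg≤2 G hIndex u*≢v* v≢u* v≢v* (maxdeg v v≢u* v≢v*))
    where
    v≢u* : v ≢ u*
    v≢u* = x∈p-y⇒x≢y ⊤ (p─q⊆p (⊤ - u*) ⁅ v* ⁆ v∈X)
    v≢v* : v ≢ v*
    v≢v* = x∈p-y⇒x≢y (⊤ - u*) v∈X

  leaves : ∀ P x → IsComponent G X P → IsPathEndpoint G P x
    → ((u* ∉ S × adj G x u* ≡ true) ⊎ (v* ∉ S × adj G x v* ≡ true))
    → P ⊆ ∁ S
  leaves P x comp (x∈P , _) (inj₁ (u*∉S , xu*)) = component∧adj∉⇒⊆∁ G closed comp x∈P xu* u*∉S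
  leaves P x comp (x∈P , _) (inj₂ (v*∉S , xv*)) = component∧adj∉⇒⊆∁ G closed comp x∈P xv* v*∉S
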